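{- Let $\mathbf L=(L,\vee,\wedge)$ be a distributive lattice and $a,b\in L$ with $a<b$ and $L=(a]\cup[a,b]\cup[b)$, and assume that there exists an antitone complementation $'$ on $([a,b],\vee,\wedge)$. Then $\mathbf L$ can be embedded (as a lattice) into $(P_{\{a,b\}}(\mathbf L),\sqcup,\sqcap)$ via the prescription \[x\mapsto\begin{cases}(x,b)&\text{if }x\leq a,\\(x,x')&\text{if }a\leq x\leq b,\\(x,a)&\text{if }b\leq x.\end{cases}\]
   Context: $(a]:=\{x\in L\mid x\leq a\}$, $[b):=\{x\in L\mid b\leq x\}$, $[a,b]:=\{x\in L\mid a\leq x\leq b\}$. For $S\subseteq L$, $P_S(\mathbf L):=\{(x,y)\in L^2\mid x\wedge y\leq z\leq x\vee y\text{ for all }z\in S\}$, with $(x,y)\sqcup(z,v):=(x\vee z,y\wedge v)$ and $(x,y)\sqcap(z,v):=(x\wedge z,y\vee v)$. An antitone complementation on $[a,b]$ is a map $x\mapsto x'$ on $[a,b]$ with $x\vee x'=b$, $x\wedge x'=a$ and $x\leq y\Rightarrow y'\leq x'$. -}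

module Defs where

open import Level using (Level; _⊔_)
open import Data.Product using (_×_; _,_; proj₁; proj₂)
open import Relation.Nullary using (¬_)
open import Algebra.Lattice.Bundles using (DistributiveLattice)

module LatticeNotions {c ℓ : Level} (𝐋 : DistributiveLattice c ℓ) where
  open DistributiveLattice 𝐋 public

  _≤_ : Carrier → Carrier → Set ℓ
  x ≤ y = (x ∧ y) ≈ x

  _<_ : Carrier → Carrier → Set ℓ
  x < y = (x ≤ y) × ¬ (x ≈ y)

  InInterval : Carrier → Carrier → Carrier → Set ℓ
  InInterval a b x = (a ≤ x) × (x ≤ b)

  Covers : Carrier → Carrier → Set (c ⊔ ℓ)
  Covers a b = ∀ x → (x ≤ a) ⊎' (InInterval a b x ⊎' (b ≤ x))
    where open import Data.Sum renaming (_⊎_ to _⊎'_)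

  -- an antitone complementation on the interval [a,b]; the map is given as a
  -- function on the carrier, only its behaviour on [a,b] is constrained
  record IsAntitoneComplementation (a b : Carrier) (_′ : Carrier → Carrier) : Set (c ⊔ ℓ) where
    field
      maps-into  : ∀ x → InInterval a b x → InInterval a b (x ′)
      join-top   : ∀ x → InInterval a b x → (x ∨ (x ′)) ≈ b
      meet-bot   : ∀ x → InInterval a b x → (x ∧ (x ′)) ≈ a
      antitone   : ∀ x y → InInterval a b x → InInterval a b y → x ≤ y → (y ′) ≤ (x ′)

  Pair : Set c
  Pair = Carrier × Carrier

  _≈₂_ : Pair → Pair → Set ℓ
  (x , y) ≈₂ (z , v) = (x ≈ z) × (y ≈ v)

  _⊔₂_ : Pair → Pair → Pair
  (x , y) ⊔₂ (z , v) = (x ∨ z , y ∧ v)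

  _⊓₂_ : Pair → Pair → Pair
  (x , y) ⊓₂ (z , v) = (x ∧ z , y ∨ v)

  InP : Carrier → Carrier → Pair → Set ℓ
  InP a b (x , y) = ((x ∧ y) ≤ a × a ≤ (x ∨ y)) × ((x ∧ y) ≤ b × b ≤ (x ∨ y))

  IsEmbeddingIntoP : Carrier → Carrier → (Carrier → Pair) → Set (c ⊔ ℓ)
  IsEmbeddingIntoP a b φ =
      (∀ x → InP a b (φ x))
    × (∀ x y → x ≈ y → φ x ≈₂ φ y)
    × (∀ x y → φ (x ∨ y) ≈₂ (φ x ⊔₂ φ y))
    × (∀ x y → φ (x ∧ y) ≈₂ (φ x ⊓₂ φ y))
    × (∀ x y → φ x ≈₂ φ y → x ≈ y)

{-# OPTIONS --safe #-}
module Submission where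

open import Defs
open import Level using (Level)
open import Data.Product using (Σ; _×_; _,_; proj₁; proj₂)
open import Algebra.Lattice.Bundles using (DistributiveLattice)
open import Algebra.Bundles using (CommutativeSemigroup)
open import Algebra.Structures using (IsCommutativeBand)
import Algebra.Lattice.Properties.Lattice as AlgebraicLatticeProperties
import Algebra.Properties.CommutativeSemigroup as CommutativeSemigroupProperties
import Relation.Binary.Lattice as Order
import Relation.Binary.Lattice.Properties.JoinSemilattice as JoinSemilatticeProperties
import Relation.Binary.Lattice.Properties.MeetSemilattice as MeetSemilatticeProperties
import Relation.Binary.Reasoning.PartialOrder as PartialOrderReasoning
import Relation.Binary.Reasoning.Setoid as SetoidReasoning

-- The second coordinate is x ↦ ((x ∨ a) ∧ b)′ on all of L, which agrees with the
-- prescribed one on each of the three regions.  Clamping x ↦ (x ∨ a) ∧ b is a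
-- lattice homomorphism onto [a,b] by distributivity, and the complementation is
-- involutive (relative complements in a distributive lattice are unique), so
-- being antitone it is a dual automorphism of [a,b]; the composite therefore
-- turns ∨ into ∧ and ∧ into ∨.  Membership in P follows from c ∧ c′ = a and
-- c ∨ c′ = b for the clamped value c.  Clamping handles the three regions
-- uniformly.

module Properties {c ℓ : Level} (𝐋 : DistributiveLattice c ℓ) where
  open LatticeNotions 𝐋
  private
    module Alg = AlgebraicLatticeProperties lattice
    module ⊑ = Order.Lattice Alg.∨-∧-orderTheoreticLattice

  -- The library orders a lattice by x ≈ x ∧ y; the order of LatticeNotions is its
  -- mirror image x ∧ y ≈ x.
  ≤-lattice : Order.Lattice c ℓ ℓ
  ≤-lattice = record
    { _≤_       = _≤_
    ; _∨_       = _∨_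
    ; _∧_       = _∧_
    ; isLattice = record
      { isPartialOrder = record
        { isPreorder = record
          { isEquivalence = isEquivalence
          ; reflexive     = λ e → sym (⊑.reflexive e)
          ; trans         = λ p q → sym (⊑.trans (sym p) (sym q))
          }
        ; antisym    = λ p q → ⊑.antisym (sym p) (sym q)
        }
      ; supremum = λ x y → let (x⊑ , y⊑ , least) = ⊑.supremum x y in
          sym x⊑ , sym y⊑ , λ z p q → sym (least z (sym p) (sym q))
      ; infimum  = λ x y → let (⊑x , ⊑y , greatest) = ⊑.infimum x y in
          sym ⊑x , sym ⊑y , λ z p q → sym (greatest z (sym p) (sym q))
      }
    }

  open Order.Lattice ≤-lattice
    using (poset; x≤x∨y; y≤x∨y; ∨-least; x∧y≤x; x∧y≤y; ∧-greatest)
    renaming (refl to ≤-refl; trans to ≤-trans; antisym to ≤-antisym; reflexive to ≤-reflexive)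
  open JoinSemilatticeProperties (Order.Lattice.joinSemilattice ≤-lattice)
    using (∨-monotonic; x≤y⇒x∨y≈y)
  open MeetSemilatticeProperties (Order.Lattice.meetSemilattice ≤-lattice)
    using (∧-monotonic; y≤x⇒x∧y≈y)
  open Alg using (∧-idem; ∨-idem)

  ∨-commutativeSemigroup : CommutativeSemigroup c ℓ
  ∨-commutativeSemigroup = record
    { isCommutativeSemigroup = IsCommutativeBand.isCommutativeSemigroup Alg.∨-isSemilattice }

  ∧-commutativeSemigroup : CommutativeSemigroup c ℓ
  ∧-commutativeSemigroup = record
    { isCommutativeSemigroup = IsCommutativeBand.isCommutativeSemigroup Alg.∧-isSemilattice }

  module ∨ = CommutativeSemigroupProperties ∨-commutativeSemigroup
  module ∧ = CommutativeSemigroupProperties ∧-commutativeSemigroup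

  module ≤-Reasoning = PartialOrderReasoning poset
  module ≈-Reasoning = SetoidReasoning setoid

  -- Applied in both directions, this makes relative complements in [a,b] unique.
  complement-≤ : ∀ {a b z x y} → x ≤ b → a ≤ y → (z ∧ x) ≤ a → b ≤ (z ∨ y) → x ≤ y
  complement-≤ {a} {b} {z} {x} {y} x≤b a≤y zx≤a b≤zy = begin
    x                  ≈⟨ sym x≤b ⟩
    x ∧ b              ≤⟨ ∧-monotonic ≤-refl b≤zy ⟩
    x ∧ (z ∨ y)        ≈⟨ ∧-distribˡ-∨ x z y ⟩
    (x ∧ z) ∨ (x ∧ y)  ≤⟨ ∨-monotonic (≤-trans (≤-reflexive (∧-comm x z)) zx≤a) (x∧y≤y x y) ⟩
    a ∨ y              ≈⟨ x≤y⇒x∨y≈y a≤y ⟩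
    y                  ∎
    where open ≤-Reasoning

  ∨-inInterval : ∀ {a b x y} → InInterval a b x → InInterval a b y → InInterval a b (x ∨ y)
  ∨-inInterval {x = x} {y} (a≤x , x≤b) (_ , y≤b) = ≤-trans a≤x (x≤x∨y x y) , ∨-least x≤b y≤b

  ∧-inInterval : ∀ {a b x y} → InInterval a b x → InInterval a b y → InInterval a b (x ∧ y)
  ∧-inInterval {x = x} {y} (a≤x , x≤b) (a≤y , _) = ∧-greatest a≤x a≤y , ≤-trans (x∧y≤x x y) x≤b

  module Clamp (a b : Carrier) (a≤b : a ≤ b) where

    clamp : Carrier → Carrier
    clamp x = (x ∨ a) ∧ b

    clamp-inInterval : ∀ x → InInterval a b (clamp x)
    clamp-inInterval x = ∧-greatest (y≤x∨y x a) a≤b , x∧y≤y (x ∨ a) b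

    clamp-cong : ∀ {x y} → x ≈ y → clamp x ≈ clamp y
    clamp-cong x≈y = ∧-congʳ (∨-congʳ x≈y)

    clamp-fixes-interval : ∀ {x} → InInterval a b x → clamp x ≈ x
    clamp-fixes-interval {x} (a≤x , x≤b) = trans (∧-congʳ (trans (∨-comm x a) (x≤y⇒x∨y≈y a≤x))) x≤b

    clamp-below : ∀ {x} → x ≤ a → clamp x ≈ a
    clamp-below x≤a = trans (∧-congʳ (x≤y⇒x∨y≈y x≤a)) a≤b

    clamp-above : ∀ {x} → b ≤ x → clamp x ≈ b
    clamp-above {x} b≤x = trans (∧-congʳ (trans (∨-comm x a) (x≤y⇒x∨y≈y (≤-trans a≤b b≤x))))
                                (y≤x⇒x∧y≈y b≤x)

    clamp-∨ : ∀ x y → clamp (x ∨ y) ≈ clamp x ∨ clamp y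
    clamp-∨ x y = begin
      ((x ∨ y) ∨ a) ∧ b              ≈⟨ ∧-congʳ (∨-congˡ (sym (∨-idem a))) ⟩
      ((x ∨ y) ∨ (a ∨ a)) ∧ b        ≈⟨ ∧-congʳ (∨.interchange x y a a) ⟩
      ((x ∨ a) ∨ (y ∨ a)) ∧ b        ≈⟨ ∧-distribʳ-∨ b (x ∨ a) (y ∨ a) ⟩
      ((x ∨ a) ∧ b) ∨ ((y ∨ a) ∧ b)  ∎
      where open ≈-Reasoning

    clamp-∧ : ∀ x y → clamp (x ∧ y) ≈ clamp x ∧ clamp y
    clamp-∧ x y = begin
      ((x ∧ y) ∨ a) ∧ b              ≈⟨ ∧-congʳ (∨-distribʳ-∧ a x y) ⟩
      ((x ∨ a) ∧ (y ∨ a)) ∧ b        ≈⟨ ∧-congˡ (sym (∧-idem b)) ⟩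
      ((x ∨ a) ∧ (y ∨ a)) ∧ (b ∧ b)  ≈⟨ ∧.interchange (x ∨ a) (y ∨ a) b b ⟩
      ((x ∨ a) ∧ b) ∧ ((y ∨ a) ∧ b)  ∎
      where open ≈-Reasoning

  module AntitoneInvolution (a b : Carrier) (a≤b : a ≤ b)
      (_′ : Carrier → Carrier) (isAC : IsAntitoneComplementation a b _′) where
    open IsAntitoneComplementation isAC

    private
      I : Carrier → Set ℓ
      I = InInterval a b

    ′-involutive : ∀ {x} → I x → (x ′) ′ ≈ x
    ′-involutive {x} x∈I@(a≤x , x≤b) =
      let x′∈I = maps-into x x∈I
          (a≤x″ , x″≤b) = maps-into (x ′) x′∈I
      in ≤-antisym
        (complement-≤ x″≤b a≤x (≤-reflexive (meet-bot (x ′) x′∈I))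
                               (≤-reflexive (sym (trans (∨-comm (x ′) x) (join-top x x∈I)))))
        (complement-≤ x≤b a≤x″ (≤-reflexive (trans (∧-comm (x ′) x) (meet-bot x x∈I)))
                               (≤-reflexive (sym (join-top (x ′) x′∈I))))

    ≤′⇒≤′ : ∀ {x y} → I x → I y → x ≤ (y ′) → y ≤ (x ′)
    ≤′⇒≤′ {x} {y} x∈I y∈I x≤y′ = begin
      y          ≈⟨ sym (′-involutive y∈I) ⟩
      (y ′) ′    ≤⟨ antitone x (y ′) x∈I (maps-into y y∈I) x≤y′ ⟩
      x ′        ∎
      where open ≤-Reasoning

    ′≤⇒′≤ : ∀ {x y} → I x → I y → (x ′) ≤ y → (y ′) ≤ x
    ′≤⇒′≤ {x} {y} x∈I y∈I x′≤y = begin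
      y ′        ≤⟨ antitone (x ′) y (maps-into x x∈I) y∈I x′≤y ⟩
      (x ′) ′    ≈⟨ ′-involutive x∈I ⟩
      x          ∎
      where open ≤-Reasoning

    ′-cong : ∀ {x y} → I x → I y → x ≈ y → x ′ ≈ y ′
    ′-cong x∈I y∈I x≈y = ≤-antisym (antitone _ _ y∈I x∈I (≤-reflexive (sym x≈y)))
                                   (antitone _ _ x∈I y∈I (≤-reflexive x≈y))

    ′-∨ : ∀ {x y} → I x → I y → (x ∨ y) ′ ≈ x ′ ∧ y ′
    ′-∨ {x} {y} x∈I y∈I = ≤-antisym
      (∧-greatest (antitone _ _ x∈I x∨y∈I (x≤x∨y x y)) (antitone _ _ y∈I x∨y∈I (y≤x∨y x y)))
      (≤′⇒≤′ x∨y∈I x′∧y′∈I (∨-least (≤′⇒≤′ x′∧y′∈I x∈I (x∧y≤x (x ′) (y ′)))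
                                    (≤′⇒≤′ x′∧y′∈I y∈I (x∧y≤y (x ′) (y ′)))))
      where
        x∨y∈I : I (x ∨ y)
        x∨y∈I = ∨-inInterval x∈I y∈I
        x′∧y′∈I : I (x ′ ∧ y ′)
        x′∧y′∈I = ∧-inInterval (maps-into x x∈I) (maps-into y y∈I)

    ′-∧ : ∀ {x y} → I x → I y → (x ∧ y) ′ ≈ x ′ ∨ y ′
    ′-∧ {x} {y} x∈I y∈I = ≤-antisym
      (′≤⇒′≤ x′∨y′∈I x∧y∈I (∧-greatest (′≤⇒′≤ x∈I x′∨y′∈I (x≤x∨y (x ′) (y ′)))
                                       (′≤⇒′≤ y∈I x′∨y′∈I (y≤x∨y (x ′) (y ′)))))
      (∨-least (antitone _ _ x∧y∈I x∈I (x∧y≤x x y)) (antitone _ _ x∧y∈I y∈I (x∧y≤y x y)))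
      where
        x∧y∈I : I (x ∧ y)
        x∧y∈I = ∧-inInterval x∈I y∈I
        x′∨y′∈I : I (x ′ ∨ y ′)
        x′∨y′∈I = ∨-inInterval (maps-into x x∈I) (maps-into y y∈I)

    ′-bottom : a ′ ≈ b
    ′-bottom = trans (sym (x≤y⇒x∨y≈y (proj₁ (maps-into a a∈I)))) (join-top a a∈I)
      where
        a∈I : I a
        a∈I = ≤-refl , a≤b

    ′-top : b ′ ≈ a
    ′-top = trans (sym (y≤x⇒x∧y≈y (proj₂ (maps-into b b∈I)))) (meet-bot b b∈I)
      where
        b∈I : I b
        b∈I = a≤b , ≤-refl

  module ClampedComplement (a b : Carrier) (a≤b : a ≤ b)
      (_′ : Carrier → Carrier) (isAC : IsAntitoneComplementation a b _′) where
    open IsAntitoneComplementation isAC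
    open Clamp a b a≤b
    open AntitoneInvolution a b a≤b _′ isAC

    clamp′ : Carrier → Carrier
    clamp′ x = clamp x ′

    clamp′-below : ∀ {x} → x ≤ a → clamp′ x ≈ b
    clamp′-below {x} x≤a = trans (′-cong (clamp-inInterval x) (≤-refl , a≤b) (clamp-below x≤a)) ′-bottom

    clamp′-interval : ∀ {x} → InInterval a b x → clamp′ x ≈ x ′
    clamp′-interval {x} x∈I = ′-cong (clamp-inInterval x) x∈I (clamp-fixes-interval x∈I)

    clamp′-above : ∀ {x} → b ≤ x → clamp′ x ≈ a
    clamp′-above {x} b≤x = trans (′-cong (clamp-inInterval x) (a≤b , ≤-refl) (clamp-above b≤x)) ′-top

    clamp′-cong : ∀ {x y} → x ≈ y → clamp′ x ≈ clamp′ y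
    clamp′-cong {x} {y} x≈y = ′-cong (clamp-inInterval x) (clamp-inInterval y) (clamp-cong x≈y)

    clamp′-∨ : ∀ x y → clamp′ (x ∨ y) ≈ clamp′ x ∧ clamp′ y
    clamp′-∨ x y = begin
      clamp (x ∨ y) ′              ≈⟨ ′-cong (clamp-inInterval (x ∨ y)) cx∨cy∈I (clamp-∨ x y) ⟩
      (clamp x ∨ clamp y) ′        ≈⟨ ′-∨ (clamp-inInterval x) (clamp-inInterval y) ⟩
      clamp x ′ ∧ clamp y ′        ∎
      where
        open ≈-Reasoning
        cx∨cy∈I : InInterval a b (clamp x ∨ clamp y)
        cx∨cy∈I = ∨-inInterval (clamp-inInterval x) (clamp-inInterval y)

    clamp′-∧ : ∀ x y → clamp′ (x ∧ y) ≈ clamp′ x ∨ clamp′ y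
    clamp′-∧ x y = begin
      clamp (x ∧ y) ′              ≈⟨ ′-cong (clamp-inInterval (x ∧ y)) cx∧cy∈I (clamp-∧ x y) ⟩
      (clamp x ∧ clamp y) ′        ≈⟨ ′-∧ (clamp-inInterval x) (clamp-inInterval y) ⟩
      clamp x ′ ∨ clamp y ′        ∎
      where
        open ≈-Reasoning
        cx∧cy∈I : InInterval a b (clamp x ∧ clamp y)
        cx∧cy∈I = ∧-inInterval (clamp-inInterval x) (clamp-inInterval y)

    clamp′-inInterval : ∀ x → InInterval a b (clamp′ x)
    clamp′-inInterval x = maps-into (clamp x) (clamp-inInterval x)

    ∧-clamp′-≤-bottom : ∀ x → (x ∧ clamp′ x) ≤ a
    ∧-clamp′-≤-bottom x = begin
      x ∧ clamp′ x              ≤⟨ ∧-monotonic (x≤x∨y x a) ≤-refl ⟩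
      (x ∨ a) ∧ clamp′ x        ≈⟨ ∧-congˡ (sym (y≤x⇒x∧y≈y (proj₂ (clamp′-inInterval x)))) ⟩
      (x ∨ a) ∧ (b ∧ clamp′ x)  ≈⟨ sym (∧-assoc (x ∨ a) b (clamp′ x)) ⟩
      clamp x ∧ clamp′ x        ≈⟨ meet-bot (clamp x) (clamp-inInterval x) ⟩
      a                         ∎
      where open ≤-Reasoning

    top-≤-∨-clamp′ : ∀ x → b ≤ (x ∨ clamp′ x)
    top-≤-∨-clamp′ x = begin
      b                         ≈⟨ sym (join-top (clamp x) (clamp-inInterval x)) ⟩
      clamp x ∨ clamp′ x        ≤⟨ ∨-monotonic (x∧y≤x (x ∨ a) b) ≤-refl ⟩
      (x ∨ a) ∨ clamp′ x        ≈⟨ ∨-assoc x a (clamp′ x) ⟩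
      x ∨ (a ∨ clamp′ x)        ≈⟨ ∨-congˡ (x≤y⇒x∨y≈y (proj₁ (clamp′-inInterval x))) ⟩
      x ∨ clamp′ x              ∎
      where open ≤-Reasoning

    inP : ∀ x → InP a b (x , clamp′ x)
    inP x = (∧-clamp′-≤-bottom x , ≤-trans a≤b (top-≤-∨-clamp′ x))
          , (≤-trans (∧-clamp′-≤-bottom x) a≤b , top-≤-∨-clamp′ x)

corollary9 : {c ℓ : Level} (𝐋 : DistributiveLattice c ℓ) →
    let open LatticeNotions 𝐋 in
    (a b : Carrier) → a < b → Covers a b →
    (_′ : Carrier → Carrier) → IsAntitoneComplementation a b _′ →
    Σ (Carrier → Pair) (λ φ →
        (∀ x → x ≤ a → φ x ≈₂ (x , b))
      × (∀ x → InInterval a b x → φ x ≈₂ (x , (x ′)))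
      × (∀ x → b ≤ x → φ x ≈₂ (x , a))
      × IsEmbeddingIntoP a b φ)
corollary9 𝐋 a b (a≤b , _) _ _′ isAC =
    (λ x → x , clamp′ x)
  , (λ x x≤a → refl , clamp′-below x≤a)
  , (λ x x∈I → refl , clamp′-interval x∈I)
  , (λ x b≤x → refl , clamp′-above b≤x)
  , inP
  , (λ x y x≈y → x≈y , clamp′-cong x≈y)
  , (λ x y → refl , clamp′-∨ x y)
  , (λ x y → refl , clamp′-∧ x y)
  , (λ x y → proj₁)
  where
    open LatticeNotions 𝐋
    open Properties 𝐋
    open ClampedComplement a b a≤b _′ isAC
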